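{- Let $D$ be a GSHDS in a finite abelian group $G$ of order $v$. Then every non-zero element $g\in G$ can be written as $g=d-d'$ with $d,d'\in D$ in at most $\frac{v-1}{4}$ ways.
   Context: Group ring notation: for a finite abelian group $G$ (additive), $D(x)=\sum_{g\in D}x^g$, $[1]=x^0$, $G(x)=\sum_gx^g$, $D(x^n)=\sum_{g\in D}x^{ng}$, $D^{(n)}=\{ng:g\in D\}$. A GSHDS in $G$ is a subset $D\subseteq G$ such that for a fixed quadratic non-residue $n_0$ modulo $\exp(G)$ and some integer $\lambda$: $D(x)+D(x^{n_0})=G(x)-[1]$ and $D(x)D(x^{n_0})=(k_0-\lambda)[1]+\lambda G(x)$, where $k_0=|D\cap D^{(-n_0)}|$. -}

module Defs where

open import Data.Bool using (Bool; true; false; if_then_else_; _∧_; T?)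
open import Data.Bool.ListAction using (any)
open import Data.Nat as ℕ using (ℕ; zero; suc)
open import Data.Nat.Coprimality using (Coprime)
open import Data.Integer as ℤ using (ℤ; +_; -[1+_])
open import Data.Integer.Divisibility using () renaming (_∣_ to _∣ℤ_)
open import Data.List using (List; []; _∷_; length; foldr; map; filter; cartesianProduct)
open import Data.List.Membership.Propositional using (_∈_)
open import Data.List.Relation.Unary.Unique.Propositional using (Unique)
open import Data.Product using (Σ; _×_; _,_; ∃)
open import Relation.Binary using (DecidableEquality)
open import Relation.Binary.PropositionalEquality using (_≡_)
open import Relation.Nullary using (¬_; does)
open import Algebra.Structures using (IsAbelianGroup)

record FiniteAbelianGroup : Set₁ where
  infixl 6 _+_
  field
    Carrier        : Set
    _+_            : Carrier → Carrier → Carrier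
    0#             : Carrier
    -_             : Carrier → Carrier
    isAbelianGroup : IsAbelianGroup _≡_ _+_ 0# -_
    _≟_            : DecidableEquality Carrier
    elems          : List Carrier
    elems-unique   : Unique elems
    elems-complete : ∀ g → g ∈ elems

  order : ℕ
  order = length elems

  _-_ : Carrier → Carrier → Carrier
  a - b = a + (- b)

  _·ℕ_ : ℕ → Carrier → Carrier
  zero  ·ℕ g = 0#
  suc n ·ℕ g = g + (n ·ℕ g)

  _·_ : ℤ → Carrier → Carrier
  (+ n)      · g = n ·ℕ g
  -[1+ n ]   · g = - (suc n ·ℕ g)

  IsExponent : ℕ → Set
  IsExponent e = (0 ℕ.< e) × (∀ g → e ·ℕ g ≡ 0#)
               × (∀ m → 0 ℕ.< m → (∀ g → m ·ℕ g ≡ 0#) → e ℕ.≤ m)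

  Subset : Set
  Subset = Carrier → Bool

  count : (Carrier → Bool) → ℕ
  count p = length (filter (λ g → T? (p g)) elems)

  dilate : ℤ → Subset → Subset
  dilate n D g = any (λ h → D h ∧ does ((n · h) ≟ g)) elems

  ∣_∩_∣ : Subset → Subset → ℕ
  ∣ A ∩ B ∣ = count (λ g → A g ∧ B g)

  -- Group ring ℤ[G]: an element is its coefficient function G → ℤ.
  GroupRing : Set
  GroupRing = Carrier → ℤ

  Σ[_] : (Carrier → ℤ) → ℤ
  Σ[ f ] = foldr (λ a s → f a ℤ.+ s) (+ 0) elems

  x^ : Carrier → GroupRing
  x^ a g = if does (a ≟ g) then + 1 else + 0

  [1] : GroupRing
  [1] = x^ 0#

  G[x] : GroupRing
  G[x] g = + 1

  _[x^_] : Subset → ℤ → GroupRing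
  (D [x^ n ]) g = Σ[ (λ d → if D d then x^ (n · d) g else + 0) ]

  _[x] : Subset → GroupRing
  D [x] = D [x^ + 1 ]

  infixl 6 _⊕_ _⊖_
  infixl 7 _⊛_ _⊙_
  _⊕_ : GroupRing → GroupRing → GroupRing
  (f ⊕ h) g = f g ℤ.+ h g

  _⊖_ : GroupRing → GroupRing → GroupRing
  (f ⊖ h) g = f g ℤ.- h g

  _⊙_ : ℤ → GroupRing → GroupRing
  (c ⊙ f) g = c ℤ.* f g

  _⊛_ : GroupRing → GroupRing → GroupRing
  (f ⊛ h) g = Σ[ (λ a → f a ℤ.* h (g - a)) ]

  _≋_ : GroupRing → GroupRing → Set
  f ≋ h = ∀ g → f g ≡ h g

  diffCount : Subset → Carrier → ℕ
  diffCount D g = length (filter (λ p → T? (D (Data.Product.proj₁ p) ∧ D (Data.Product.proj₂ p)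
                                        ∧ does ((Data.Product.proj₁ p - Data.Product.proj₂ p) ≟ g)))
                                 (cartesianProduct elems elems))

QuadraticNonResidue : ℤ → ℕ → Set
QuadraticNonResidue n m =
  Coprime (ℤ.∣ n ∣) m × (∀ (x : ℤ) → ¬ ((+ m) ∣ℤ (x ℤ.* x ℤ.- n)))

module _ (G : FiniteAbelianGroup) where
  open FiniteAbelianGroup G

  record IsGSHDS (D : Subset) (n₀ : ℤ) (λ' : ℤ) : Set where
    field
      exponent    : ℕ
      isExponent  : IsExponent exponent
      nonResidue  : QuadraticNonResidue n₀ exponent
      sumEq       : (D [x] ⊕ D [x^ n₀ ]) ≋ (G[x] ⊖ [1])
      prodEq      : (D [x] ⊛ D [x^ n₀ ])
                      ≋ (((+ ∣ D ∩ dilate (ℤ.- n₀) D ∣) ℤ.- λ') ⊙ [1] ⊕ λ' ⊙ G[x])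

  GSHDS : Subset → Set
  GSHDS D = Σ ℤ λ n₀ → Σ ℤ λ λ' → IsGSHDS D n₀ λ'

-- Write s = |D| and v = |G|. Coefficientwise, D(x) + D(x^{n₀}) = G(x) - [1] says that D(x^{n₀}) is the
-- indicator of G ∖ (D ∪ {0}), so 2s = v - 1, and for g ≠ 0 the coefficient of x^g in D(x)D(x^{n₀})
-- gives Σ_{a ∈ D} D(x^{n₀})(g - a) = λ. Summing all coefficients of the product equation gives
-- s² = (k₀ - λ) + λv, i.e. k₀ = s(s - 2λ), and 0 ≤ k₀ ≤ s leaves three cases: s = 0 (no pairs at all);
-- s = 2λ with k₀ = 0; s = 2λ + 1 with k₀ = s. As y ∈ D^{(-n₀)} exactly when D(x^{n₀}) is positive at -y,
-- for k₀ = 0 we get 𝟙_D(y) ≤ 1 - D(x^{n₀})(-y), so the number of pairs with d - d' = g is at most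
-- Σ_{a ∈ D} (1 - D(x^{n₀})(g - a)) = s - λ = s/2; for k₀ = s we get 𝟙_D(y) ≤ D(x^{n₀})(-y), and the
-- number is at most λ < s/2.

module Submission where

open import Algebra.Bundles using (AbelianGroup)
import Algebra.Properties.AbelianGroup as AbelianGroupProperties
open import Data.Bool using (Bool; true; false; T; _∧_; T?; if_then_else_)
open import Data.Bool.ListAction using (any)
open import Data.Bool.Properties using (T-∧)
open import Data.Empty using (⊥-elim)
open import Data.Integer as ℤ using (ℤ; +_; -[1+_]; +≤+; _*_; _≤_)
import Data.Integer.Properties as ℤₚ
open import Data.Integer.Tactic.RingSolver using (solve-∀)
open import Data.List using (List; []; _∷_; foldr; length; filter; map; cartesianProduct; _++_)
open import Data.List.Membership.Propositional using (_∈_)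
open import Data.List.Relation.Unary.All as All using (All; []; _∷_)
open import Data.List.Relation.Unary.AllPairs using ([]; _∷_)
open import Data.List.Relation.Unary.Any using (here; there)
open import Data.List.Relation.Unary.Unique.Propositional using (Unique)
open import Data.Nat as ℕ using (ℕ; zero; suc)
import Data.Nat.Properties as ℕₚ
open import Data.Product using (_×_; _,_)
open import Data.Sum using (_⊎_; inj₁; inj₂)
open import Data.Unit using (tt)
open import Function using (_∘_)
open import Function.Bundles using (Equivalence)
open import Level using (0ℓ)
open import Relation.Binary.PropositionalEquality
open import Relation.Nullary using (¬_; does; yes; no)

open import Defs

module IntegerSums where
  open import Algebra.Properties.CommutativeSemigroup ℤₚ.+-commutativeSemigroup using (interchange)
  open import Data.Integer using (_+_; _-_; -_)

  private variable
    A B : Set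

  ∑ : (A → ℤ) → List A → ℤ
  ∑ f = foldr (λ x s → f x + s) (+ 0)

  ∑-cong : ∀ {f g : A → ℤ} xs → (∀ x → f x ≡ g x) → ∑ f xs ≡ ∑ g xs
  ∑-cong []       f≗g = refl
  ∑-cong (x ∷ xs) f≗g = cong₂ _+_ (f≗g x) (∑-cong xs f≗g)

  ∑-zero : ∀ {f : A → ℤ} {xs} → All (λ x → f x ≡ + 0) xs → ∑ f xs ≡ + 0
  ∑-zero []              = refl
  ∑-zero (fx≡0 ∷ fxs≡0) = cong₂ _+_ fx≡0 (∑-zero fxs≡0)

  ∑-distrib-+ : ∀ (f g : A → ℤ) xs → ∑ (λ x → f x + g x) xs ≡ ∑ f xs + ∑ g xs
  ∑-distrib-+ f g []       = refl
  ∑-distrib-+ f g (x ∷ xs) =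
    trans (cong (_+_ (f x + g x)) (∑-distrib-+ f g xs)) (interchange (f x) (g x) (∑ f xs) (∑ g xs))

  ∑-neg : ∀ (f : A → ℤ) xs → ∑ (λ x → - f x) xs ≡ - ∑ f xs
  ∑-neg f []       = refl
  ∑-neg f (x ∷ xs) =
    trans (cong (_+_ (- f x)) (∑-neg f xs)) (sym (ℤₚ.neg-distrib-+ (f x) (∑ f xs)))

  ∑-distrib-minus : ∀ (f g : A → ℤ) xs → ∑ (λ x → f x - g x) xs ≡ ∑ f xs - ∑ g xs
  ∑-distrib-minus f g xs = trans (∑-distrib-+ f (λ x → - g x) xs) (cong (_+_ (∑ f xs)) (∑-neg g xs))

  ∑-*ˡ : ∀ c (f : A → ℤ) xs → ∑ (λ x → c * f x) xs ≡ c * ∑ f xs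
  ∑-*ˡ c f []       = sym (ℤₚ.*-zeroʳ c)
  ∑-*ˡ c f (x ∷ xs) =
    trans (cong (_+_ (c * f x)) (∑-*ˡ c f xs)) (sym (ℤₚ.*-distribˡ-+ c (f x) (∑ f xs)))

  ∑-*ʳ : ∀ c (f : A → ℤ) xs → ∑ (λ x → f x * c) xs ≡ ∑ f xs * c
  ∑-*ʳ c f []       = sym (ℤₚ.*-zeroˡ c)
  ∑-*ʳ c f (x ∷ xs) =
    trans (cong (_+_ (f x * c)) (∑-*ʳ c f xs)) (sym (ℤₚ.*-distribʳ-+ c (f x) (∑ f xs)))

  ∑-const-1 : ∀ (xs : List A) → ∑ (λ _ → + 1) xs ≡ + length xs
  ∑-const-1 []       = refl
  ∑-const-1 (x ∷ xs) = cong (_+_ (+ 1)) (∑-const-1 xs)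

  ∑-swap : ∀ (f : A → B → ℤ) xs ys →
           ∑ (λ x → ∑ (f x) ys) xs ≡ ∑ (λ y → ∑ (λ x → f x y) xs) ys
  ∑-swap f []       ys = sym (∑-zero (All.universal (λ _ → refl) ys))
  ∑-swap f (x ∷ xs) ys =
    trans (cong (_+_ (∑ (f x) ys)) (∑-swap f xs ys))
          (sym (∑-distrib-+ (f x) (λ y → ∑ (λ x → f x y) xs) ys))

  ∑-++ : ∀ (f : A → ℤ) xs ys → ∑ f (xs ++ ys) ≡ ∑ f xs + ∑ f ys
  ∑-++ f []       ys = sym (ℤₚ.+-identityˡ (∑ f ys))
  ∑-++ f (x ∷ xs) ys =
    trans (cong (_+_ (f x)) (∑-++ f xs ys)) (sym (ℤₚ.+-assoc (f x) (∑ f xs) (∑ f ys)))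

  ∑-map : ∀ (f : B → ℤ) (h : A → B) xs → ∑ f (map h xs) ≡ ∑ (f ∘ h) xs
  ∑-map f h []       = refl
  ∑-map f h (x ∷ xs) = cong (_+_ (f (h x))) (∑-map f h xs)

  ∑-cartesianProduct : ∀ (f : A × B → ℤ) xs ys →
                       ∑ f (cartesianProduct xs ys) ≡ ∑ (λ x → ∑ (λ y → f (x , y)) ys) xs
  ∑-cartesianProduct f []       ys = refl
  ∑-cartesianProduct f (x ∷ xs) ys =
    trans (∑-++ f (map (x ,_) ys) (cartesianProduct xs ys))
          (cong₂ _+_ (∑-map f (x ,_) ys) (∑-cartesianProduct f xs ys))

  ∑-delta : ∀ {f : A → ℤ} {xs c} → Unique xs → c ∈ xs →
            (∀ x → x ≢ c → f x ≡ + 0) → ∑ f xs ≡ f c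
  ∑-delta {f = f} {x ∷ xs} (x∉xs ∷ _) (here refl) f≡0 =
    trans (cong (_+_ (f x)) (∑-zero (All.map (λ x≢y → f≡0 _ (x≢y ∘ sym)) x∉xs)))
          (ℤₚ.+-identityʳ (f x))
  ∑-delta {f = f} {x ∷ xs} (x∉xs ∷ xs-unique) (there c∈xs) f≡0 =
    trans (cong (_+ ∑ f xs) (f≡0 x (All.lookup x∉xs c∈xs)))
          (trans (ℤₚ.+-identityˡ (∑ f xs)) (∑-delta xs-unique c∈xs f≡0))

  ∑-mono-≤ : ∀ {f g : A → ℤ} xs → (∀ x → f x ≤ g x) → ∑ f xs ≤ ∑ g xs
  ∑-mono-≤ []       f≤g = ℤₚ.≤-refl
  ∑-mono-≤ (x ∷ xs) f≤g = ℤₚ.+-mono-≤ (f≤g x) (∑-mono-≤ xs f≤g)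

  ∑-nonNeg : ∀ {f : A → ℤ} xs → (∀ x → + 0 ≤ f x) → + 0 ≤ ∑ f xs
  ∑-nonNeg xs 0≤f = ℤₚ.≤-trans (ℤₚ.≤-reflexive (sym (∑-zero (All.universal (λ _ → refl) xs))))
                              (∑-mono-≤ xs 0≤f)

  term≤∑ : ∀ {f : A → ℤ} {xs x} → (∀ y → + 0 ≤ f y) → x ∈ xs → f x ≤ ∑ f xs
  term≤∑ {f = f} {x ∷ xs} 0≤f (here refl) =
    subst (_≤ f x + ∑ f xs) (ℤₚ.+-identityʳ (f x)) (ℤₚ.+-monoʳ-≤ (f x) (∑-nonNeg xs 0≤f))
  term≤∑ {f = f} {x ∷ xs} 0≤f (there y∈xs) =
    ℤₚ.≤-trans (term≤∑ 0≤f y∈xs)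
               (subst (_≤ f x + ∑ f xs) (ℤₚ.+-identityˡ (∑ f xs)) (ℤₚ.+-monoˡ-≤ (∑ f xs) (0≤f x)))

  ∑≡0⇒term≡0 : ∀ {f : A → ℤ} {xs x} → (∀ y → + 0 ≤ f y) →
               ∑ f xs ≡ + 0 → x ∈ xs → f x ≡ + 0
  ∑≡0⇒term≡0 0≤f ∑≡0 x∈xs =
    ℤₚ.≤-antisym (ℤₚ.≤-trans (term≤∑ 0≤f x∈xs) (ℤₚ.≤-reflexive ∑≡0)) (0≤f _)

  𝟙 : Bool → ℤ
  𝟙 b = if b then + 1 else + 0

  𝟙-nonNeg : ∀ b → + 0 ≤ 𝟙 b
  𝟙-nonNeg true  = +≤+ ℕ.z≤n
  𝟙-nonNeg false = +≤+ ℕ.z≤n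

  𝟙≤1 : ∀ b → 𝟙 b ≤ + 1
  𝟙≤1 true  = ℤₚ.≤-refl
  𝟙≤1 false = +≤+ ℕ.z≤n

  𝟙-∧ : ∀ a b → 𝟙 (a ∧ b) ≡ 𝟙 a * 𝟙 b
  𝟙-∧ true  b = sym (ℤₚ.*-identityˡ (𝟙 b))
  𝟙-∧ false b = refl

  𝟙-∧-≤ : ∀ a b → 𝟙 (a ∧ b) ≤ 𝟙 a
  𝟙-∧-≤ true  b = 𝟙≤1 b
  𝟙-∧-≤ false b = ℤₚ.≤-refl

  𝟙-*-monoˡ-≤ : ∀ b {x y} → x ≤ y → 𝟙 b * x ≤ 𝟙 b * y
  𝟙-*-monoˡ-≤ true  {x} {y} x≤y = subst₂ _≤_ (sym (ℤₚ.*-identityˡ x)) (sym (ℤₚ.*-identityˡ y)) x≤y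
  𝟙-*-monoˡ-≤ false x≤y = ℤₚ.≤-refl

  𝟙≡0⇒¬T : ∀ {b} → 𝟙 b ≡ + 0 → ¬ T b
  𝟙≡0⇒¬T {true} ()

  count≡∑𝟙 : ∀ (p : A → Bool) xs → + length (filter (T? ∘ p) xs) ≡ ∑ (𝟙 ∘ p) xs
  count≡∑𝟙 p []       = refl
  count≡∑𝟙 p (x ∷ xs) with p x
  ... | true  = cong (_+_ (+ 1)) (count≡∑𝟙 p xs)
  ... | false = trans (count≡∑𝟙 p xs) (sym (ℤₚ.+-identityˡ _))

  any⇒1≤∑𝟙 : ∀ (p : A → Bool) xs → T (any p xs) → + 1 ≤ ∑ (𝟙 ∘ p) xs
  any⇒1≤∑𝟙 p (x ∷ xs) t with p x
  ... | true  = ℤₚ.+-monoʳ-≤ (+ 1) (∑-nonNeg xs (𝟙-nonNeg ∘ p))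
  ... | false = subst (+ 1 ≤_) (sym (ℤₚ.+-identityˡ _)) (any⇒1≤∑𝟙 p xs t)

  ¬any⇒∑𝟙≡0 : ∀ (p : A → Bool) xs → ¬ T (any p xs) → ∑ (𝟙 ∘ p) xs ≡ + 0
  ¬any⇒∑𝟙≡0 p []       _ = refl
  ¬any⇒∑𝟙≡0 p (x ∷ xs) ¬t with p x
  ... | true  = ⊥-elim (¬t tt)
  ... | false = trans (ℤₚ.+-identityˡ _) (¬any⇒∑𝟙≡0 p xs ¬t)

  ∑𝟙∧≡0⇒ : ∀ (p q : A → Bool) {xs x} → ∑ (λ y → 𝟙 (p y ∧ q y)) xs ≡ + 0 →
           x ∈ xs → T (p x) → ¬ T (q x)
  ∑𝟙∧≡0⇒ p q ∑≡0 x∈xs px qx =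
    𝟙≡0⇒¬T (∑≡0⇒term≡0 (λ y → 𝟙-nonNeg (p y ∧ q y)) ∑≡0 x∈xs)
           (Equivalence.from T-∧ (px , qx))

  ∑𝟙∧≡∑𝟙⇒ : ∀ (p q : A → Bool) {xs x} →
            ∑ (λ y → 𝟙 (p y ∧ q y)) xs ≡ ∑ (𝟙 ∘ p) xs → x ∈ xs → T (p x) → T (q x)
  ∑𝟙∧≡∑𝟙⇒ p q {xs} {x} ∑≡∑ x∈xs px =
    gap≡0⇒ (p x) (q x) px
      (∑≡0⇒term≡0 (λ y → ℤₚ.i≤j⇒0≤j-i (𝟙-∧-≤ (p y) (q y))) ∑gap≡0 x∈xs)
    where
    ∑gap≡0 : ∑ (λ y → 𝟙 (p y) - 𝟙 (p y ∧ q y)) xs ≡ + 0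
    ∑gap≡0 = trans (∑-distrib-minus (𝟙 ∘ p) (λ y → 𝟙 (p y ∧ q y)) xs)
                   (trans (cong (_-_ (∑ (𝟙 ∘ p) xs)) ∑≡∑) (ℤₚ.+-inverseʳ (∑ (𝟙 ∘ p) xs)))
    gap≡0⇒ : ∀ a b → T a → 𝟙 a - 𝟙 (a ∧ b) ≡ + 0 → T b
    gap≡0⇒ true true  _ _ = tt
    gap≡0⇒ true false _ ()

open IntegerSums

bounded-multiple : ∀ s k m → + k ≡ + s * m → k ℕ.≤ s → s ≡ 0 ⊎ m ≡ + 0 ⊎ m ≡ + 1
bounded-multiple zero    k m                 _   _   = inj₁ refl
bounded-multiple (suc s) k (+ 0)             _   _   = inj₂ (inj₁ refl)
bounded-multiple (suc s) k (+ 1)             _   _   = inj₂ (inj₂ refl)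
bounded-multiple (suc s) k (+ suc (suc j))   k≡  k≤s =
  ⊥-elim (ℕₚ.m+1+n≰m (suc s) (subst (ℕ._≤ suc s) k≡[2+j]*[1+s] k≤s))
  where
  k≡[2+j]*[1+s] : k ≡ suc (suc j) ℕ.* suc s
  k≡[2+j]*[1+s] = trans (ℤₚ.+-injective (trans k≡ (sym (ℤₚ.pos-* (suc s) (suc (suc j))))))
                        (ℕₚ.*-comm (suc s) (suc (suc j)))
bounded-multiple (suc s) k -[1+ j ]          ()  _

4[s-l]≡2s+2[s-2l] : ∀ s l → + 4 * (s ℤ.- l) ≡ s ℤ.+ s ℤ.+ + 2 * (s ℤ.- (l ℤ.+ l))
4[s-l]≡2s+2[s-2l] = solve-∀

4l≡2s-2[s-2l] : ∀ s l → + 4 * l ≡ s ℤ.+ s ℤ.- + 2 * (s ℤ.- (l ℤ.+ l))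
4l≡2s-2[s-2l] = solve-∀

module GroupRingAugmentation (G : FiniteAbelianGroup) where
  open FiniteAbelianGroup G

  abelianGroup : AbelianGroup 0ℓ 0ℓ
  abelianGroup = record { isAbelianGroup = isAbelianGroup }

  open AbelianGroup abelianGroup using (comm; identityʳ)
  open AbelianGroupProperties abelianGroup
    using ( ⁻¹-anti-homo‿-; ⁻¹-involutive; ε⁻¹≈ε
          ; \\-leftDividesˡ; //-rightDividesˡ; //-rightDividesʳ)

  x-[x-y]≡y : ∀ x y → x - (x - y) ≡ y
  x-[x-y]≡y x y = begin
    x + - (x - y) ≡⟨ cong (_+_ x) (⁻¹-anti-homo‿- x y) ⟩
    x + (y - x)   ≡⟨ cong (_+_ x) (comm y (- x)) ⟩
    x + (- x + y) ≡⟨ \\-leftDividesˡ x y ⟩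
    y             ∎
    where open ≡-Reasoning

  neg-· : ∀ n h → (ℤ.- n) · h ≡ - (n · h)
  neg-· (+ zero)  h = sym ε⁻¹≈ε
  neg-· (+ suc m) h = refl
  neg-· -[1+ m ]  h = sym (⁻¹-involutive _)

  x^-self : ∀ a → x^ a a ≡ + 1
  x^-self a with a ≟ a
  ... | yes _   = refl
  ... | no a≢a = ⊥-elim (a≢a refl)

  x^-≢ : ∀ {a b} → a ≢ b → x^ a b ≡ + 0
  x^-≢ {a} {b} a≢b with a ≟ b
  ... | yes a≡b = ⊥-elim (a≢b a≡b)
  ... | no _    = refl

  Σ-delta : ∀ (f : Carrier → ℤ) c → (∀ x → x ≢ c → f x ≡ + 0) → Σ[ f ] ≡ f c
  Σ-delta f c = ∑-delta elems-unique (elems-complete c)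

  Σ-x^ : ∀ c → Σ[ x^ c ] ≡ + 1
  Σ-x^ c = trans (Σ-delta (x^ c) c (λ x x≢c → x^-≢ (x≢c ∘ sym))) (x^-self c)

  Σ-sift : ∀ (f : Carrier → ℤ) c → Σ[ (λ x → f x * x^ x c) ] ≡ f c
  Σ-sift f c = begin
    Σ[ (λ x → f x * x^ x c) ]
      ≡⟨ Σ-delta _ c (λ x x≢c → trans (cong (f x *_) (x^-≢ x≢c)) (ℤₚ.*-zeroʳ (f x))) ⟩
    f c * x^ c c
      ≡⟨ cong (f c *_) (x^-self c) ⟩
    f c * + 1
      ≡⟨ ℤₚ.*-identityʳ (f c) ⟩
    f c ∎
    where open ≡-Reasoning

  Σ-shift : ∀ (f : Carrier → ℤ) a → Σ[ (λ h → f (h - a)) ] ≡ Σ[ f ]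
  Σ-shift f a = begin
    Σ[ (λ h → f (h - a)) ]
      ≡⟨ ∑-cong elems (λ h → sym (Σ-sift f (h - a))) ⟩
    Σ[ (λ h → Σ[ (λ x → f x * x^ x (h - a)) ]) ]
      ≡⟨ ∑-swap (λ h x → f x * x^ x (h - a)) elems elems ⟩
    Σ[ (λ x → Σ[ (λ h → f x * x^ x (h - a)) ]) ]
      ≡⟨ ∑-cong elems column ⟩
    Σ[ f ] ∎
    where
    open ≡-Reasoning
    column : ∀ x → Σ[ (λ h → f x * x^ x (h - a)) ] ≡ f x
    column x = begin
      Σ[ (λ h → f x * x^ x (h - a)) ] ≡⟨ Σ-delta _ (x + a) off-diagonal ⟩
      f x * x^ x ((x + a) - a)        ≡⟨ cong (λ y → f x * x^ x y) (//-rightDividesʳ a x) ⟩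
      f x * x^ x x                    ≡⟨ cong (f x *_) (x^-self x) ⟩
      f x * + 1                       ≡⟨ ℤₚ.*-identityʳ (f x) ⟩
      f x                             ∎
      where
      off-diagonal : ∀ h → h ≢ x + a → f x * x^ x (h - a) ≡ + 0
      off-diagonal h h≢x+a = trans (cong (f x *_) (x^-≢ λ x≡h-a →
        h≢x+a (trans (sym (//-rightDividesˡ a h)) (cong (_+ a) (sym x≡h-a)))))
        (ℤₚ.*-zeroʳ (f x))

  Σ-⊕ : ∀ f h → Σ[ f ⊕ h ] ≡ Σ[ f ] ℤ.+ Σ[ h ]
  Σ-⊕ f h = ∑-distrib-+ f h elems

  Σ-⊖ : ∀ f h → Σ[ f ⊖ h ] ≡ Σ[ f ] ℤ.- Σ[ h ]
  Σ-⊖ f h = ∑-distrib-minus f h elems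

  Σ-⊙ : ∀ c f → Σ[ c ⊙ f ] ≡ c * Σ[ f ]
  Σ-⊙ c f = ∑-*ˡ c f elems

  Σ-G[x] : Σ[ G[x] ] ≡ + order
  Σ-G[x] = ∑-const-1 elems

  Σ-⊛ : ∀ f h → Σ[ f ⊛ h ] ≡ Σ[ f ] * Σ[ h ]
  Σ-⊛ f h = begin
    Σ[ (λ g → Σ[ (λ a → f a * h (g - a)) ]) ] ≡⟨ ∑-swap (λ g a → f a * h (g - a)) elems elems ⟩
    Σ[ (λ a → Σ[ (λ g → f a * h (g - a)) ]) ] ≡⟨ ∑-cong elems (λ a → ∑-*ˡ (f a) _ elems) ⟩
    Σ[ (λ a → f a * Σ[ (λ g → h (g - a)) ]) ] ≡⟨ ∑-cong elems (λ a → cong (f a *_) (Σ-shift h a)) ⟩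
    Σ[ (λ a → f a * Σ[ h ]) ]                 ≡⟨ ∑-*ʳ Σ[ h ] f elems ⟩
    Σ[ f ] * Σ[ h ]                           ∎
    where open ≡-Reasoning

  [x^]-count : ∀ (D : Subset) n g → (D [x^ n ]) g ≡ ∑ (λ d → 𝟙 (D d ∧ does ((n · d) ≟ g))) elems
  [x^]-count D n g = ∑-cong elems term
    where
    term : ∀ d → (if D d then x^ (n · d) g else + 0) ≡ 𝟙 (D d ∧ does ((n · d) ≟ g))
    term d with D d
    ... | true  = refl
    ... | false = refl

  [x]≡𝟙 : ∀ (D : Subset) g → (D [x]) g ≡ 𝟙 (D g)
  [x]≡𝟙 D g = begin
    (D [x]) g
      ≡⟨ [x^]-count D (+ 1) g ⟩
    Σ[ (λ d → 𝟙 (D d ∧ does (((+ 1) · d) ≟ g))) ]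
      ≡⟨ ∑-cong elems (λ d → 𝟙-∧ (D d) _) ⟩
    Σ[ (λ d → 𝟙 (D d) * x^ ((+ 1) · d) g) ]
      ≡⟨ ∑-cong elems (λ d → cong (λ y → 𝟙 (D d) * x^ y g) (identityʳ d)) ⟩
    Σ[ (λ d → 𝟙 (D d) * x^ d g) ]
      ≡⟨ Σ-sift (𝟙 ∘ D) g ⟩
    𝟙 (D g) ∎
    where open ≡-Reasoning

  Σ-[x^] : ∀ (D : Subset) n → Σ[ D [x^ n ] ] ≡ Σ[ 𝟙 ∘ D ]
  Σ-[x^] D n = begin
    Σ[ D [x^ n ] ]
      ≡⟨ ∑-cong elems ([x^]-count D n) ⟩
    Σ[ (λ g → Σ[ (λ d → 𝟙 (D d ∧ does ((n · d) ≟ g))) ]) ]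
      ≡⟨ ∑-swap (λ g d → 𝟙 (D d ∧ does ((n · d) ≟ g))) elems elems ⟩
    Σ[ (λ d → Σ[ (λ g → 𝟙 (D d ∧ does ((n · d) ≟ g))) ]) ]
      ≡⟨ ∑-cong elems row ⟩
    Σ[ 𝟙 ∘ D ] ∎
    where
    open ≡-Reasoning
    row : ∀ d → Σ[ (λ g → 𝟙 (D d ∧ does ((n · d) ≟ g))) ] ≡ 𝟙 (D d)
    row d = begin
      Σ[ (λ g → 𝟙 (D d ∧ does ((n · d) ≟ g))) ] ≡⟨ ∑-cong elems (λ g → 𝟙-∧ (D d) _) ⟩
      Σ[ (λ g → 𝟙 (D d) * x^ (n · d) g) ]       ≡⟨ ∑-*ˡ (𝟙 (D d)) (x^ (n · d)) elems ⟩
      𝟙 (D d) * Σ[ x^ (n · d) ]                 ≡⟨ cong (𝟙 (D d) *_) (Σ-x^ (n · d)) ⟩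
      𝟙 (D d) * + 1                             ≡⟨ ℤₚ.*-identityʳ (𝟙 (D d)) ⟩
      𝟙 (D d)                                   ∎

  [x^]-nonNeg : ∀ (D : Subset) n g → + 0 ≤ (D [x^ n ]) g
  [x^]-nonNeg D n g = ℤₚ.≤-trans (∑-nonNeg elems (λ d → 𝟙-nonNeg (D d ∧ _)))
                                (ℤₚ.≤-reflexive (sym ([x^]-count D n g)))

  [x^]-at-neg : ∀ (D : Subset) n x →
                (D [x^ n ]) (- x) ≡ ∑ (λ d → 𝟙 (D d ∧ does (((ℤ.- n) · d) ≟ x))) elems
  [x^]-at-neg D n x =
    trans ([x^]-count D n (- x)) (∑-cong elems λ d → cong (λ b → 𝟙 (D d ∧ b)) (same-test d))
    where
    same-test : ∀ d → does ((n · d) ≟ (- x)) ≡ does (((ℤ.- n) · d) ≟ x)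
    same-test d rewrite neg-· n d with (n · d) ≟ (- x) | (- (n · d)) ≟ x
    ... | yes _  | yes _   = refl
    ... | no _   | no _    = refl
    ... | yes eq | no neq  = ⊥-elim (neq (trans (cong -_ eq) (⁻¹-involutive x)))
    ... | no neq | yes eq  = ⊥-elim (neq (trans (sym (⁻¹-involutive _)) (cong -_ eq)))

  dilate⇒1≤[x^] : ∀ (D : Subset) n x → T (dilate (ℤ.- n) D x) → + 1 ≤ (D [x^ n ]) (- x)
  dilate⇒1≤[x^] D n x t = ℤₚ.≤-trans (any⇒1≤∑𝟙 _ elems t) (ℤₚ.≤-reflexive (sym ([x^]-at-neg D n x)))

  ¬dilate⇒[x^]≡0 : ∀ (D : Subset) n x → ¬ T (dilate (ℤ.- n) D x) → (D [x^ n ]) (- x) ≡ + 0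
  ¬dilate⇒[x^]≡0 D n x ¬t = trans ([x^]-at-neg D n x) (¬any⇒∑𝟙≡0 _ elems ¬t)

  diffSum : Subset → Carrier → ℤ
  diffSum D g = Σ[ (λ a → 𝟙 (D a) * 𝟙 (D (a - g))) ]

  diffCount≡diffSum : ∀ D g → + diffCount D g ≡ diffSum D g
  diffCount≡diffSum D g = begin
    + diffCount D g
      ≡⟨ count≡∑𝟙 represents (cartesianProduct elems elems) ⟩
    ∑ (𝟙 ∘ represents) (cartesianProduct elems elems)
      ≡⟨ ∑-cartesianProduct (𝟙 ∘ represents) elems elems ⟩
    Σ[ (λ a → Σ[ (λ b → 𝟙 (D a ∧ D b ∧ does ((a - b) ≟ g))) ]) ]
      ≡⟨ ∑-cong elems (λ a → ∑-cong elems (λ b →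
           trans (𝟙-∧ (D a) _) (cong (𝟙 (D a) *_) (𝟙-∧ (D b) _)))) ⟩
    Σ[ (λ a → Σ[ (λ b → 𝟙 (D a) * (𝟙 (D b) * x^ (a - b) g)) ]) ]
      ≡⟨ ∑-cong elems (λ a → trans (∑-*ˡ (𝟙 (D a)) _ elems) (cong (𝟙 (D a) *_) (partner a))) ⟩
    diffSum D g ∎
    where
    open ≡-Reasoning
    represents : Carrier × Carrier → Bool
    represents (a , b) = D a ∧ D b ∧ does ((a - b) ≟ g)
    partner : ∀ a → Σ[ (λ b → 𝟙 (D b) * x^ (a - b) g) ] ≡ 𝟙 (D (a - g))
    partner a = begin
      Σ[ (λ b → 𝟙 (D b) * x^ (a - b) g) ] ≡⟨ Σ-delta _ (a - g) off ⟩
      𝟙 (D (a - g)) * x^ (a - (a - g)) g  ≡⟨ cong (λ y → 𝟙 (D (a - g)) * x^ y g) (x-[x-y]≡y a g) ⟩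
      𝟙 (D (a - g)) * x^ g g              ≡⟨ cong (𝟙 (D (a - g)) *_) (x^-self g) ⟩
      𝟙 (D (a - g)) * + 1                 ≡⟨ ℤₚ.*-identityʳ _ ⟩
      𝟙 (D (a - g))                       ∎
      where
      off : ∀ b → b ≢ a - g → 𝟙 (D b) * x^ (a - b) g ≡ + 0
      off b b≢a-g = trans (cong (𝟙 (D b) *_) (x^-≢ λ a-b≡g →
        b≢a-g (trans (sym (x-[x-y]≡y a b)) (cong (_-_ a) a-b≡g)))) (ℤₚ.*-zeroʳ (𝟙 (D b)))

  diffSum-≤ : ∀ D (φ : Carrier → ℤ) → (∀ y → 𝟙 (D y) ≤ φ (- y)) →
              ∀ g → diffSum D g ≤ Σ[ (λ a → 𝟙 (D a) * φ (g - a)) ]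
  diffSum-≤ D φ D≤φ g = ∑-mono-≤ elems λ a →
    𝟙-*-monoˡ-≤ (D a) (ℤₚ.≤-trans (D≤φ (a - g)) (ℤₚ.≤-reflexive (cong φ (⁻¹-anti-homo‿- a g))))

module GSHDSProperties (G : FiniteAbelianGroup) (D : FiniteAbelianGroup.Subset G)
                       (n₀ λ' : ℤ) (isGSHDS : IsGSHDS G D n₀ λ') where
  open FiniteAbelianGroup G
  open GroupRingAugmentation G
  open IsGSHDS isGSHDS

  ∣D∣ : ℕ
  ∣D∣ = count D

  D⁻ⁿ⁰ : Subset
  D⁻ⁿ⁰ = dilate (ℤ.- n₀) D

  k₀ : ℕ
  k₀ = ∣ D ∩ D⁻ⁿ⁰ ∣

  Dⁿ⁰ : GroupRing
  Dⁿ⁰ = D [x^ n₀ ]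

  ∣D∣≡Σ : + ∣D∣ ≡ Σ[ 𝟙 ∘ D ]
  ∣D∣≡Σ = count≡∑𝟙 D elems

  k₀≡Σ : + k₀ ≡ Σ[ (λ x → 𝟙 (D x ∧ D⁻ⁿ⁰ x)) ]
  k₀≡Σ = count≡∑𝟙 (λ x → D x ∧ D⁻ⁿ⁰ x) elems

  k₀≤∣D∣ : k₀ ℕ.≤ ∣D∣
  k₀≤∣D∣ = ℤₚ.drop‿+≤+ (begin
    + k₀                          ≡⟨ k₀≡Σ ⟩
    Σ[ (λ x → 𝟙 (D x ∧ D⁻ⁿ⁰ x)) ] ≤⟨ ∑-mono-≤ elems (λ x → 𝟙-∧-≤ (D x) (D⁻ⁿ⁰ x)) ⟩
    Σ[ 𝟙 ∘ D ]                    ≡⟨ ∣D∣≡Σ ⟨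
    + ∣D∣                         ∎)
    where open ℤₚ.≤-Reasoning

  Σ-D[x^] : ∀ n → Σ[ D [x^ n ] ] ≡ + ∣D∣
  Σ-D[x^] n = trans (Σ-[x^] D n) (sym ∣D∣≡Σ)

  Σ-[x] : Σ[ D [x] ] ≡ + ∣D∣
  Σ-[x] = Σ-D[x^] (+ 1)

  size-eq : + ∣D∣ ℤ.+ + ∣D∣ ≡ + order ℤ.- + 1
  size-eq = begin
    + ∣D∣ ℤ.+ + ∣D∣         ≡⟨ cong₂ ℤ._+_ Σ-[x] (Σ-D[x^] n₀) ⟨
    Σ[ D [x] ] ℤ.+ Σ[ Dⁿ⁰ ] ≡⟨ Σ-⊕ (D [x]) Dⁿ⁰ ⟨
    Σ[ D [x] ⊕ Dⁿ⁰ ]        ≡⟨ ∑-cong elems sumEq ⟩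
    Σ[ G[x] ⊖ [1] ]         ≡⟨ Σ-⊖ G[x] [1] ⟩
    Σ[ G[x] ] ℤ.- Σ[ [1] ]  ≡⟨ cong₂ ℤ._-_ Σ-G[x] (Σ-x^ 0#) ⟩
    + order ℤ.- + 1         ∎
    where open ≡-Reasoning

  order≡2∣D∣+1 : order ≡ ∣D∣ ℕ.+ ∣D∣ ℕ.+ 1
  order≡2∣D∣+1 = ℤₚ.+-injective (begin
    + order                 ≡⟨ v≡[v-1]+1 (+ order) ⟩
    + order ℤ.- + 1 ℤ.+ + 1 ≡⟨ cong (ℤ._+ + 1) size-eq ⟨
    + ∣D∣ ℤ.+ + ∣D∣ ℤ.+ + 1 ∎)
    where
    open ≡-Reasoning
    v≡[v-1]+1 : ∀ v → v ≡ v ℤ.- + 1 ℤ.+ + 1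
    v≡[v-1]+1 = solve-∀

  product-eq : + ∣D∣ * + ∣D∣ ≡ (+ k₀ ℤ.- λ') * + 1 ℤ.+ λ' * (+ ∣D∣ ℤ.+ + ∣D∣ ℤ.+ + 1)
  product-eq = begin
    + ∣D∣ * + ∣D∣
      ≡⟨ cong₂ _*_ Σ-[x] (Σ-D[x^] n₀) ⟨
    Σ[ D [x] ] * Σ[ Dⁿ⁰ ]
      ≡⟨ Σ-⊛ (D [x]) Dⁿ⁰ ⟨
    Σ[ D [x] ⊛ Dⁿ⁰ ]
      ≡⟨ ∑-cong elems prodEq ⟩
    Σ[ (+ k₀ ℤ.- λ') ⊙ [1] ⊕ λ' ⊙ G[x] ]
      ≡⟨ Σ-⊕ ((+ k₀ ℤ.- λ') ⊙ [1]) (λ' ⊙ G[x]) ⟩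
    Σ[ (+ k₀ ℤ.- λ') ⊙ [1] ] ℤ.+ Σ[ λ' ⊙ G[x] ]
      ≡⟨ cong₂ ℤ._+_ (Σ-⊙ (+ k₀ ℤ.- λ') [1]) (Σ-⊙ λ' G[x]) ⟩
    (+ k₀ ℤ.- λ') * Σ[ [1] ] ℤ.+ λ' * Σ[ G[x] ]
      ≡⟨ cong₂ (λ a b → (+ k₀ ℤ.- λ') * a ℤ.+ λ' * b) (Σ-x^ 0#) Σ-G[x] ⟩
    (+ k₀ ℤ.- λ') * + 1 ℤ.+ λ' * + order
      ≡⟨ cong (λ v → (+ k₀ ℤ.- λ') * + 1 ℤ.+ λ' * + v) order≡2∣D∣+1 ⟩
    (+ k₀ ℤ.- λ') * + 1 ℤ.+ λ' * (+ ∣D∣ ℤ.+ + ∣D∣ ℤ.+ + 1) ∎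
    where open ≡-Reasoning

  ∣D∣-2λ : ℤ
  ∣D∣-2λ = + ∣D∣ ℤ.- (λ' ℤ.+ λ')

  k₀≡∣D∣*[∣D∣-2λ] : + k₀ ≡ + ∣D∣ * ∣D∣-2λ
  k₀≡∣D∣*[∣D∣-2λ] = begin
    + k₀
      ≡⟨ isolate-k (+ k₀) λ' s ⟩
    (+ k₀ ℤ.- λ') * + 1 ℤ.+ λ' * (s ℤ.+ s ℤ.+ + 1) ℤ.- λ' * (s ℤ.+ s)
      ≡⟨ cong (ℤ._- λ' * (s ℤ.+ s)) product-eq ⟨
    s * s ℤ.- λ' * (s ℤ.+ s)
      ≡⟨ factor λ' s ⟩
    s * ∣D∣-2λ ∎
    where
    open ≡-Reasoning
    s = + ∣D∣
    isolate-k : ∀ k l s → k ≡ (k ℤ.- l) * + 1 ℤ.+ l * (s ℤ.+ s ℤ.+ + 1) ℤ.- l * (s ℤ.+ s)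
    isolate-k = solve-∀
    factor : ∀ l s → s * s ℤ.- l * (s ℤ.+ s) ≡ s * (s ℤ.- (l ℤ.+ l))
    factor = solve-∀

  λ-eq : ∀ {g} → g ≢ 0# → Σ[ (λ a → 𝟙 (D a) * Dⁿ⁰ (g - a)) ] ≡ λ'
  λ-eq {g} g≢0 = begin
    Σ[ (λ a → 𝟙 (D a) * Dⁿ⁰ (g - a)) ]
      ≡⟨ ∑-cong elems (λ a → cong (_* Dⁿ⁰ (g - a)) ([x]≡𝟙 D a)) ⟨
    (D [x] ⊛ Dⁿ⁰) g
      ≡⟨ prodEq g ⟩
    (+ k₀ ℤ.- λ') * x^ 0# g ℤ.+ λ' * + 1
      ≡⟨ cong₂ (λ a b → (+ k₀ ℤ.- λ') * a ℤ.+ b) (x^-≢ (g≢0 ∘ sym)) (ℤₚ.*-identityʳ λ') ⟩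
    (+ k₀ ℤ.- λ') * + 0 ℤ.+ λ'
      ≡⟨ cong (ℤ._+ λ') (ℤₚ.*-zeroʳ (+ k₀ ℤ.- λ')) ⟩
    + 0 ℤ.+ λ'
      ≡⟨ ℤₚ.+-identityˡ λ' ⟩
    λ' ∎
    where open ≡-Reasoning

  Dⁿ⁰≤1 : ∀ y → Dⁿ⁰ y ≤ + 1
  Dⁿ⁰≤1 y = begin
    Dⁿ⁰ y             ≡⟨ ℤₚ.+-identityˡ (Dⁿ⁰ y) ⟨
    + 0 ℤ.+ Dⁿ⁰ y     ≤⟨ ℤₚ.+-monoˡ-≤ (Dⁿ⁰ y) (𝟙-nonNeg (D y)) ⟩
    𝟙 (D y) ℤ.+ Dⁿ⁰ y ≡⟨ cong (ℤ._+ Dⁿ⁰ y) ([x]≡𝟙 D y) ⟨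
    (D [x] ⊕ Dⁿ⁰) y   ≡⟨ sumEq y ⟩
    + 1 ℤ.- x^ 0# y   ≤⟨ ℤₚ.+-monoʳ-≤ (+ 1) (ℤₚ.neg-mono-≤ (𝟙-nonNeg (does (0# ≟ y)))) ⟩
    + 1               ∎
    where open ℤₚ.≤-Reasoning

  𝟙D≤1-Dⁿ⁰∘neg : (∀ x → T (D x) → ¬ T (D⁻ⁿ⁰ x)) → ∀ y → 𝟙 (D y) ≤ + 1 ℤ.- Dⁿ⁰ (- y)
  𝟙D≤1-Dⁿ⁰∘neg D∩D⁻ⁿ⁰=∅ y with D y | D∩D⁻ⁿ⁰=∅ y
  ... | false | _       = ℤₚ.i≤j⇒0≤j-i (Dⁿ⁰≤1 (- y))
  ... | true  | ¬-y∈D⁻ⁿ⁰ =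
    ℤₚ.≤-reflexive (sym (cong (ℤ._-_ (+ 1)) (¬dilate⇒[x^]≡0 D n₀ y (¬-y∈D⁻ⁿ⁰ tt))))

  𝟙D≤Dⁿ⁰∘neg : (∀ x → T (D x) → T (D⁻ⁿ⁰ x)) → ∀ y → 𝟙 (D y) ≤ Dⁿ⁰ (- y)
  𝟙D≤Dⁿ⁰∘neg D⊆D⁻ⁿ⁰ y with D y | D⊆D⁻ⁿ⁰ y
  ... | false | _       = [x^]-nonNeg D n₀ (- y)
  ... | true  | -y∈D⁻ⁿ⁰ = dilate⇒1≤[x^] D n₀ y (-y∈D⁻ⁿ⁰ tt)

  diffSum≤∣D∣ : ∀ g → diffSum D g ≤ + ∣D∣
  diffSum≤∣D∣ g = begin
    diffSum D g                ≤⟨ diffSum-≤ D (λ _ → + 1) (𝟙≤1 ∘ D) g ⟩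
    Σ[ (λ a → 𝟙 (D a) * + 1) ] ≡⟨ ∑-cong elems (ℤₚ.*-identityʳ ∘ 𝟙 ∘ D) ⟩
    Σ[ 𝟙 ∘ D ]                 ≡⟨ ∣D∣≡Σ ⟨
    + ∣D∣                      ∎
    where open ℤₚ.≤-Reasoning

  diffSum≤∣D∣-λ : (∀ x → T (D x) → ¬ T (D⁻ⁿ⁰ x)) → ∀ {g} → g ≢ 0# → diffSum D g ≤ + ∣D∣ ℤ.- λ'
  diffSum≤∣D∣-λ D∩D⁻ⁿ⁰=∅ {g} g≢0 = begin
    diffSum D g
      ≤⟨ diffSum-≤ D (λ y → + 1 ℤ.- Dⁿ⁰ y) (𝟙D≤1-Dⁿ⁰∘neg D∩D⁻ⁿ⁰=∅) g ⟩
    Σ[ (λ a → 𝟙 (D a) * (+ 1 ℤ.- Dⁿ⁰ (g - a))) ]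
      ≡⟨ ∑-cong elems (λ a → distrib (𝟙 (D a)) (Dⁿ⁰ (g - a))) ⟩
    Σ[ (λ a → 𝟙 (D a) ℤ.- 𝟙 (D a) * Dⁿ⁰ (g - a)) ]
      ≡⟨ ∑-distrib-minus (𝟙 ∘ D) (λ a → 𝟙 (D a) * Dⁿ⁰ (g - a)) elems ⟩
    Σ[ 𝟙 ∘ D ] ℤ.- Σ[ (λ a → 𝟙 (D a) * Dⁿ⁰ (g - a)) ]
      ≡⟨ cong₂ ℤ._-_ (sym ∣D∣≡Σ) (λ-eq g≢0) ⟩
    + ∣D∣ ℤ.- λ' ∎
    where
    open ℤₚ.≤-Reasoning
    distrib : ∀ a b → a * (+ 1 ℤ.- b) ≡ a ℤ.- a * b
    distrib = solve-∀

  diffSum≤λ : (∀ x → T (D x) → T (D⁻ⁿ⁰ x)) → ∀ {g} → g ≢ 0# → diffSum D g ≤ λ'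
  diffSum≤λ D⊆D⁻ⁿ⁰ {g} g≢0 =
    ℤₚ.≤-trans (diffSum-≤ D Dⁿ⁰ (𝟙D≤Dⁿ⁰∘neg D⊆D⁻ⁿ⁰) g) (ℤₚ.≤-reflexive (λ-eq g≢0))

  k₀≡0⇒D∩D⁻ⁿ⁰=∅ : + k₀ ≡ + 0 → ∀ x → T (D x) → ¬ T (D⁻ⁿ⁰ x)
  k₀≡0⇒D∩D⁻ⁿ⁰=∅ k₀≡0 x = ∑𝟙∧≡0⇒ D D⁻ⁿ⁰ (trans (sym k₀≡Σ) k₀≡0) (elems-complete x)

  k₀≡∣D∣⇒D⊆D⁻ⁿ⁰ : + k₀ ≡ + ∣D∣ → ∀ x → T (D x) → T (D⁻ⁿ⁰ x)
  k₀≡∣D∣⇒D⊆D⁻ⁿ⁰ k₀≡∣D∣ x = ∑𝟙∧≡∑𝟙⇒ D D⁻ⁿ⁰ (trans (sym k₀≡Σ) (trans k₀≡∣D∣ ∣D∣≡Σ)) (elems-complete x)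

  4*diffSum≤2∣D∣ : ∀ {g} → g ≢ 0# → + 4 * diffSum D g ≤ + ∣D∣ ℤ.+ + ∣D∣
  4*diffSum≤2∣D∣ {g} g≢0 with bounded-multiple ∣D∣ k₀ ∣D∣-2λ k₀≡∣D∣*[∣D∣-2λ] k₀≤∣D∣
  ... | inj₁ ∣D∣≡0 = begin
    + 4 * diffSum D g ≤⟨ ℤₚ.*-monoˡ-≤-nonNeg (+ 4) (diffSum≤∣D∣ g) ⟩
    + 4 * + ∣D∣       ≡⟨ cong (λ n → + 4 * + n) ∣D∣≡0 ⟩
    + 0               ≡⟨ cong (λ n → + n ℤ.+ + n) ∣D∣≡0 ⟨
    + ∣D∣ ℤ.+ + ∣D∣   ∎
    where open ℤₚ.≤-Reasoning
  ... | inj₂ (inj₁ [∣D∣-2λ]≡0) = begin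
    + 4 * diffSum D g                ≤⟨ ℤₚ.*-monoˡ-≤-nonNeg (+ 4) (diffSum≤∣D∣-λ D∩D⁻ⁿ⁰=∅ g≢0) ⟩
    + 4 * (+ ∣D∣ ℤ.- λ')             ≡⟨ 4[s-l]≡2s+2[s-2l] (+ ∣D∣) λ' ⟩
    + ∣D∣ ℤ.+ + ∣D∣ ℤ.+ + 2 * ∣D∣-2λ ≡⟨ cong (λ m → + ∣D∣ ℤ.+ + ∣D∣ ℤ.+ + 2 * m) [∣D∣-2λ]≡0 ⟩
    + ∣D∣ ℤ.+ + ∣D∣ ℤ.+ + 0          ≡⟨ ℤₚ.+-identityʳ (+ ∣D∣ ℤ.+ + ∣D∣) ⟩
    + ∣D∣ ℤ.+ + ∣D∣                  ∎
    where
    open ℤₚ.≤-Reasoning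
    D∩D⁻ⁿ⁰=∅ : ∀ x → T (D x) → ¬ T (D⁻ⁿ⁰ x)
    D∩D⁻ⁿ⁰=∅ = k₀≡0⇒D∩D⁻ⁿ⁰=∅
      (trans k₀≡∣D∣*[∣D∣-2λ] (trans (cong (+ ∣D∣ *_) [∣D∣-2λ]≡0) (ℤₚ.*-zeroʳ (+ ∣D∣))))
  ... | inj₂ (inj₂ [∣D∣-2λ]≡1) = begin
    + 4 * diffSum D g                ≤⟨ ℤₚ.*-monoˡ-≤-nonNeg (+ 4) (diffSum≤λ D⊆D⁻ⁿ⁰ g≢0) ⟩
    + 4 * λ'                         ≡⟨ 4l≡2s-2[s-2l] (+ ∣D∣) λ' ⟩
    + ∣D∣ ℤ.+ + ∣D∣ ℤ.- + 2 * ∣D∣-2λ ≡⟨ cong (λ m → + ∣D∣ ℤ.+ + ∣D∣ ℤ.- + 2 * m) [∣D∣-2λ]≡1 ⟩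
    + ∣D∣ ℤ.+ + ∣D∣ ℤ.- + 2          ≤⟨ ℤₚ.i-j≤i (+ ∣D∣ ℤ.+ + ∣D∣) (+ 2) ⟩
    + ∣D∣ ℤ.+ + ∣D∣                  ∎
    where
    open ℤₚ.≤-Reasoning
    D⊆D⁻ⁿ⁰ : ∀ x → T (D x) → T (D⁻ⁿ⁰ x)
    D⊆D⁻ⁿ⁰ = k₀≡∣D∣⇒D⊆D⁻ⁿ⁰
      (trans k₀≡∣D∣*[∣D∣-2λ] (trans (cong (+ ∣D∣ *_) [∣D∣-2λ]≡1) (ℤₚ.*-identityʳ (+ ∣D∣))))

lemma2 : (G : FiniteAbelianGroup) (D : FiniteAbelianGroup.Subset G) →
         GSHDS G D →
         ∀ (g : FiniteAbelianGroup.Carrier G) → g ≢ FiniteAbelianGroup.0# G →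
         4 ℕ.* FiniteAbelianGroup.diffCount G D g ℕ.≤ FiniteAbelianGroup.order G ℕ.∸ 1
lemma2 G D (n₀ , λ' , isGSHDS) g g≢0 = begin
  4 ℕ.* diffCount D g     ≤⟨ ℤₚ.drop‿+≤+ 4*diffCount≤2∣D∣ ⟩
  ∣D∣ ℕ.+ ∣D∣             ≡⟨ ℕₚ.m+n∸n≡m (∣D∣ ℕ.+ ∣D∣) 1 ⟨
  ∣D∣ ℕ.+ ∣D∣ ℕ.+ 1 ℕ.∸ 1 ≡⟨ cong (ℕ._∸ 1) order≡2∣D∣+1 ⟨
  order ℕ.∸ 1             ∎
  where
  open FiniteAbelianGroup G
  open GroupRingAugmentation G
  open GSHDSProperties G D n₀ λ' isGSHDS
  open ℕₚ.≤-Reasoning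
  4*diffCount≤2∣D∣ : + (4 ℕ.* diffCount D g) ≤ + ∣D∣ ℤ.+ + ∣D∣
  4*diffCount≤2∣D∣ = ℤₚ.≤-trans
    (ℤₚ.≤-reflexive (trans (ℤₚ.pos-* 4 (diffCount D g)) (cong (_*_ (+ 4)) (diffCount≡diffSum D g))))
    (4*diffSum≤2∣D∣ g≢0)
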